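{- Let $T=\langle T,\wedge,\vee,\rightarrow,\sim,0,1\rangle$ be a hemi-Nelson algebra and let $\theta$ be the relation on $T$ given by $x\,\theta\,y$ iff $x\rightarrow y=1$ and $y\rightarrow x=1$. Then the map $\rho_T:T\to \mathrm{K}(T/\theta)$ defined by $\rho_T(x)=(x/\theta,\ \sim x/\theta)$ is well defined and is a monomorphism (injective homomorphism of algebras of type $(2,2,2,1,0,0)$).
   Context: A Kleene algebra is a bounded distributive lattice $\langle T,\wedge,\vee,0,1\rangle$ with a unary operation $\sim$ such that $\sim\sim x=x$, $\sim(x\wedge y)=\sim x\vee\sim y$ and $(x\wedge\sim x)\wedge(y\vee\sim y)=x\wedge\sim x$. A hemi-Nelson algebra is an algebra $\langle T,\wedge,\vee,\rightarrow,\sim,0,1\rangle$ of type $(2,2,2,1,0,0)$ such that $\langle T,\wedge,\vee,\sim,0,1\rangle$ is a Kleene algebra and for all $x,y,z\in T$: (hN1) $x\rightarrow x=1$; (hN2) $x\wedge(x\rightarrow y)\le x\wedge(\sim x\vee y)$; (hN3) $\sim(x\rightarrow y)\rightarrow(x\wedge\sim y)=1$; (hN4) $(x\wedge\sim y)\rightarrow\sim(x\rightarrow y)=1$; (hN5) $(x\wedge y\wedge(x\rightarrow y))\rightarrow(x\wedge(x\rightarrow y))=1$; (hN6) $(x\wedge(x\rightarrow y))\rightarrow(x\wedge y\wedge(x\rightarrow y))=1$; (hN7) if $x\rightarrow y=1$, $y\rightarrow x=1$, $y\rightarrow z=1$ and $z\rightarrow y=1$ then $x\rightarrow z=1$ and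 $z\rightarrow x=1$; (hN8) if $x\rightarrow y=1$ and $y\rightarrow x=1$ then $(x\wedge z)\rightarrow(y\wedge z)=1$; (hN9) if $x\rightarrow y=1$ and $y\rightarrow x=1$ then $(x\vee z)\rightarrow(y\vee z)=1$; (hN10) if $x\rightarrow y=1$ and $y\rightarrow x=1$ then $(x\rightarrow z)\rightarrow(y\rightarrow z)=1$ and $(z\rightarrow x)\rightarrow(z\rightarrow y)=1$. An h-lattice is an algebra $\langle A,\wedge,\vee,\rightarrow,0,1\rangle$ of type $(2,2,2,0,0)$ such that $\langle A,\wedge,\vee,0,1\rangle$ is a bounded distributive lattice, $a\rightarrow a=1$ and $a\wedge(a\rightarrow b)\le b$ for all $a,b$. For an h-lattice $A$, $\mathrm{K}(A)=\{(a,b)\in A\times A: a\wedge b=0\}$ with operations $(a,b)\wedge(c,d)=(a\wedge c,b\vee d)$, $(a,b)\vee(c,d)=(a\vee c,b\wedge d)$, $\sim(a,b)=(b,a)$, $(a,b)\rightarrow(c,d)=(a\rightarrow c,a\wedge d)$, constants $0=(0,1)$, $1=(1,0)$. For a hemi-Nelson algebra $T$, the relation $\theta$ above is an equivalence relation compatible with $\wedge,\vee,\rightarrow$, and $T/\theta$ with the induced operations $x/\theta\wedge y/\theta=(x\wedge y)/\theta$, $x/\theta\vee y/\theta=(x\vee y)/\theta$, $x/\theta\rightarrow y/\theta=(x\rightarrow y)/\theta$, constants $0/\theta,1/\theta$, is an h-lattice; $\mathrm{K}(T/\theta)$ refers to this h-lattice. -}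

module Defs where

open import Level using (Level)
open import Data.Product using (_×_; _,_; proj₁; proj₂)
open import Relation.Binary.PropositionalEquality using (_≡_)
open import Algebra.Core using (Op₁; Op₂)
open import Algebra.Lattice.Structures using (IsDistributiveLattice)

record HemiNelson (T : Set) : Set where
  infixr 7 _∧_
  infixr 6 _∨_
  infixr 5 _⇒_
  field
    _∧_ _∨_ _⇒_ : Op₂ T
    ∼_ : Op₁ T
    𝟘 𝟙 : T
    isDistributiveLattice : IsDistributiveLattice _≡_ _∨_ _∧_
    ∨-identityʳ : ∀ x → x ∨ 𝟘 ≡ x
    ∧-identityʳ : ∀ x → x ∧ 𝟙 ≡ x

  infix 4 _≤_
  _≤_ : T → T → Set
  x ≤ y = x ∧ y ≡ x

  field
    ∼-invol   : ∀ x → ∼ (∼ x) ≡ x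
    ∼-deMorgan : ∀ x y → ∼ (x ∧ y) ≡ (∼ x) ∨ (∼ y)
    kleene    : ∀ x y → (x ∧ ∼ x) ∧ (y ∨ ∼ y) ≡ x ∧ ∼ x
    hN1 : ∀ x → x ⇒ x ≡ 𝟙
    hN2 : ∀ x y → x ∧ (x ⇒ y) ≤ x ∧ ((∼ x) ∨ y)
    hN3 : ∀ x y → (∼ (x ⇒ y)) ⇒ (x ∧ ∼ y) ≡ 𝟙
    hN4 : ∀ x y → (x ∧ ∼ y) ⇒ (∼ (x ⇒ y)) ≡ 𝟙
    hN5 : ∀ x y → (x ∧ y ∧ (x ⇒ y)) ⇒ (x ∧ (x ⇒ y)) ≡ 𝟙
    hN6 : ∀ x y → (x ∧ (x ⇒ y)) ⇒ (x ∧ y ∧ (x ⇒ y)) ≡ 𝟙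
    hN7 : ∀ x y z → x ⇒ y ≡ 𝟙 → y ⇒ x ≡ 𝟙 → y ⇒ z ≡ 𝟙 → z ⇒ y ≡ 𝟙 →
          (x ⇒ z ≡ 𝟙) × (z ⇒ x ≡ 𝟙)
    hN8 : ∀ x y z → x ⇒ y ≡ 𝟙 → y ⇒ x ≡ 𝟙 → (x ∧ z) ⇒ (y ∧ z) ≡ 𝟙
    hN9 : ∀ x y z → x ⇒ y ≡ 𝟙 → y ⇒ x ≡ 𝟙 → (x ∨ z) ⇒ (y ∨ z) ≡ 𝟙
    hN10 : ∀ x y z → x ⇒ y ≡ 𝟙 → y ⇒ x ≡ 𝟙 →
           ((x ⇒ z) ⇒ (y ⇒ z) ≡ 𝟙) × ((z ⇒ x) ⇒ (z ⇒ y) ≡ 𝟙)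

  -- the relation θ; T/θ is represented as T with equality θ (setoid quotient)
  infix 4 _θ_
  _θ_ : T → T → Set
  x θ y = (x ⇒ y ≡ 𝟙) × (y ⇒ x ≡ 𝟙)

  -- K(T/θ): pairs (a/θ, b/θ) with a/θ ∧ b/θ = 0/θ, i.e. (a ∧ b) θ 𝟘.
  -- Elements are represented by pairs of representatives in T × T.
  InK : T × T → Set
  InK (a , b) = (a ∧ b) θ 𝟘

  infix 4 _≈K_
  _≈K_ : T × T → T × T → Set
  (a , b) ≈K (c , d) = (a θ c) × (b θ d)

  _∧K_ : T × T → T × T → T × T
  (a , b) ∧K (c , d) = (a ∧ c , b ∨ d)

  _∨K_ : T × T → T × T → T × T
  (a , b) ∨K (c , d) = (a ∨ c , b ∧ d)

  _⇒K_ : T × T → T × T → T × T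
  (a , b) ⇒K (c , d) = (a ⇒ c , a ∧ d)

  ∼K_ : T × T → T × T
  ∼K (a , b) = (b , a)

  𝟘K 𝟙K : T × T
  𝟘K = (𝟘 , 𝟙)
  𝟙K = (𝟙 , 𝟘)

  ρ : T → T × T
  ρ x = (x , ∼ x)

{-# OPTIONS --safe #-}
-- The first component of ρ commutes with every operation on the nose, and the
-- second one does by the De Morgan laws, except for ⇒, where it is exactly
-- hN3 and hN4.  For injectivity, x ⇒ y = 1 gives x ≤ ∼x ∨ y by hN2, while
-- ∼y ⇒ ∼x = 1 gives ∼y ≤ y ∨ ∼x, i.e. x ∧ ∼y ≤ y after contraposition.  The
-- Kleene inequality x ∧ ∼x ≤ y ∨ ∼y upgrades the latter to x ∧ ∼x ≤ y, and
-- then x = (x ∧ ∼x) ∨ (x ∧ y) ≤ y.  So ρ x ≈K ρ y forces x ≤ y and y ≤ x.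
module Submission where

open import Data.Product using (_×_; _,_; swap)
open import Relation.Binary.PropositionalEquality
  using (_≡_; refl; sym; trans; cong; cong₂; subst; module ≡-Reasoning)
open import Algebra.Core using (Op₁; Op₂)
open import Algebra.Lattice.Bundles using (DistributiveLattice)
open import Algebra.Lattice.Structures using (IsDistributiveLattice)
import Algebra.Lattice.Properties.Lattice as LatticeProperties
import Relation.Binary.Lattice as OrderTheoretic
import Relation.Binary.Reasoning.PartialOrder as PosetReasoning
open import Defs

module DistributiveLatticeOrder {c ℓ} (L : DistributiveLattice c ℓ) where
  open DistributiveLattice L
  open LatticeProperties lattice public using (poset)
  open LatticeProperties lattice using (∨-∧-orderTheoreticLattice)
  open OrderTheoretic.Lattice ∨-∧-orderTheoreticLattice public
    using (_≤_; antisym; x∧y≤x; x∧y≤y; y≤x∨y; ∧-greatest; ∨-least)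
    renaming (trans to ≤-trans)
  open PosetReasoning poset

  -- Here x ≤ y unfolds to x ≈ x ∧ y, so an equation x ∧ y ≡ x read
  -- backwards (as with hN2 and kleene) is a proof of x ≤ y.
  ≤-by-∨-cases : ∀ {a u v b} → a ≤ u ∨ v → a ∧ u ≤ b → a ∧ v ≤ b → a ≤ b
  ≤-by-∨-cases {a} {u} {v} {b} a≤u∨v a∧u≤b a∧v≤b = begin
    a              ≈⟨ a≤u∨v ⟩
    a ∧ (u ∨ v)    ≈⟨ ∧-distribˡ-∨ a u v ⟩
    a ∧ u ∨ a ∧ v  ≤⟨ ∨-least a∧u≤b a∧v≤b ⟩
    b              ∎

record KleeneAlgebra (T : Set) : Set where
  infixr 7 _∧_
  infixr 6 _∨_
  field
    _∧_ _∨_ : Op₂ T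
    ∼_ : Op₁ T
    𝟘 𝟙 : T
    isDistributiveLattice : IsDistributiveLattice _≡_ _∨_ _∧_
    ∨-identityʳ : ∀ x → x ∨ 𝟘 ≡ x
    ∧-identityʳ : ∀ x → x ∧ 𝟙 ≡ x
    ∼-invol : ∀ x → ∼ (∼ x) ≡ x
    ∼-deMorgan : ∀ x y → ∼ (x ∧ y) ≡ (∼ x) ∨ (∼ y)
    kleene : ∀ x y → (x ∧ ∼ x) ∧ (y ∨ ∼ y) ≡ x ∧ ∼ x

  distributiveLattice : DistributiveLattice _ _
  distributiveLattice = record { isDistributiveLattice = isDistributiveLattice }

kleeneAlgebra : ∀ {T} → HemiNelson T → KleeneAlgebra T
kleeneAlgebra H = record
  { _∧_ = _∧_
  ; _∨_ = _∨_
  ; ∼_ = ∼_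
  ; 𝟘 = 𝟘
  ; 𝟙 = 𝟙
  ; isDistributiveLattice = isDistributiveLattice
  ; ∨-identityʳ = ∨-identityʳ
  ; ∧-identityʳ = ∧-identityʳ
  ; ∼-invol = ∼-invol
  ; ∼-deMorgan = ∼-deMorgan
  ; kleene = kleene
  }
  where open HemiNelson H

module KleeneAlgebraProperties {T : Set} (K : KleeneAlgebra T) where
  open KleeneAlgebra K
  open IsDistributiveLattice isDistributiveLattice using (∧-comm; ∨-comm)
  open DistributiveLatticeOrder distributiveLattice

  ∼-deMorgan-∨ : ∀ x y → ∼ (x ∨ y) ≡ ∼ x ∧ ∼ y
  ∼-deMorgan-∨ x y = begin
    ∼ (x ∨ y)          ≡⟨ cong ∼_ (cong₂ _∨_ (sym (∼-invol x)) (sym (∼-invol y))) ⟩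
    ∼ (∼ ∼ x ∨ ∼ ∼ y)  ≡⟨ cong ∼_ (sym (∼-deMorgan (∼ x) (∼ y))) ⟩
    ∼ ∼ (∼ x ∧ ∼ y)    ≡⟨ ∼-invol (∼ x ∧ ∼ y) ⟩
    ∼ x ∧ ∼ y          ∎
    where open ≡-Reasoning

  ∼𝟙≡𝟘 : ∼ 𝟙 ≡ 𝟘
  ∼𝟙≡𝟘 = begin
    ∼ 𝟙            ≡⟨ sym (∨-identityʳ (∼ 𝟙)) ⟩
    ∼ 𝟙 ∨ 𝟘        ≡⟨ ∨-comm (∼ 𝟙) 𝟘 ⟩
    𝟘 ∨ ∼ 𝟙        ≡⟨ cong (_∨ ∼ 𝟙) (sym (∼-invol 𝟘)) ⟩
    ∼ ∼ 𝟘 ∨ ∼ 𝟙    ≡⟨ sym (∼-deMorgan (∼ 𝟘) 𝟙) ⟩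
    ∼ (∼ 𝟘 ∧ 𝟙)    ≡⟨ cong ∼_ (∧-identityʳ (∼ 𝟘)) ⟩
    ∼ ∼ 𝟘          ≡⟨ ∼-invol 𝟘 ⟩
    𝟘              ∎
    where open ≡-Reasoning

  ∼𝟘≡𝟙 : ∼ 𝟘 ≡ 𝟙
  ∼𝟘≡𝟙 = trans (cong ∼_ (sym ∼𝟙≡𝟘)) (∼-invol 𝟙)

  ∼-antitone : ∀ {x y} → x ≤ y → ∼ y ≤ ∼ x
  ∼-antitone {x} {y} x≤y = begin
    ∼ y        ≤⟨ y≤x∨y (∼ x) (∼ y) ⟩
    ∼ x ∨ ∼ y  ≡⟨ sym (∼-deMorgan x y) ⟩
    ∼ (x ∧ y)  ≡⟨ cong ∼_ (sym x≤y) ⟩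
    ∼ x        ∎
    where open PosetReasoning poset

  x≤y∨∼z⇒z∧∼y≤∼x : ∀ {x y z} → x ≤ y ∨ ∼ z → z ∧ ∼ y ≤ ∼ x
  x≤y∨∼z⇒z∧∼y≤∼x {x} {y} {z} x≤y∨∼z = begin
    z ∧ ∼ y        ≡⟨ ∧-comm z (∼ y) ⟩
    ∼ y ∧ z        ≡⟨ cong (∼ y ∧_) (sym (∼-invol z)) ⟩
    ∼ y ∧ ∼ ∼ z    ≡⟨ sym (∼-deMorgan-∨ y (∼ z)) ⟩
    ∼ (y ∨ ∼ z)    ≤⟨ ∼-antitone x≤y∨∼z ⟩
    ∼ x            ∎
    where open PosetReasoning poset

  -- The Kleene axiom says x ∧ ∼x ≤ y ∨ ∼y; split on that cover.
  x∧∼y≤y⇒x∧∼x≤y : ∀ {x y} → x ∧ ∼ y ≤ y → x ∧ ∼ x ≤ y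
  x∧∼y≤y⇒x∧∼x≤y {x} {y} x∧∼y≤y =
    ≤-by-∨-cases (sym (kleene x y)) (x∧y≤y (x ∧ ∼ x) y) (≤-trans x∧∼x∧∼y≤x∧∼y x∧∼y≤y)
    where
    x∧∼x∧∼y≤x∧∼y : (x ∧ ∼ x) ∧ ∼ y ≤ x ∧ ∼ y
    x∧∼x∧∼y≤x∧∼y = ∧-greatest (≤-trans (x∧y≤x _ _) (x∧y≤x x (∼ x))) (x∧y≤y _ _)

module HemiNelsonProperties {T : Set} (H : HemiNelson T) where
  open HemiNelson H hiding (_≤_)
  open KleeneAlgebraProperties (kleeneAlgebra H)
  open DistributiveLatticeOrder (KleeneAlgebra.distributiveLattice (kleeneAlgebra H))

  θ-refl : ∀ x → x θ x
  θ-refl x = hN1 x , hN1 x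

  θ-reflexive : ∀ {x y} → x ≡ y → x θ y
  θ-reflexive {x} refl = θ-refl x

  ∼⇒θ∧∼ : ∀ x y → ∼ (x ⇒ y) θ x ∧ ∼ y
  ∼⇒θ∧∼ x y = hN3 x y , hN4 x y

  ⇒≡𝟙⇒≤∼∨ : ∀ {x y} → x ⇒ y ≡ 𝟙 → x ≤ ∼ x ∨ y
  ⇒≡𝟙⇒≤∼∨ {x} {y} x⇒y≡𝟙 = begin
    x              ≡⟨ sym (trans (cong (x ∧_) x⇒y≡𝟙) (∧-identityʳ x)) ⟩
    x ∧ (x ⇒ y)    ≤⟨ sym (hN2 x y) ⟩
    x ∧ (∼ x ∨ y)  ≤⟨ x∧y≤y x (∼ x ∨ y) ⟩
    ∼ x ∨ y        ∎
    where open PosetReasoning poset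

  ⇒≡𝟙⇒≤ : ∀ {x y} → x ⇒ y ≡ 𝟙 → ∼ y ⇒ ∼ x ≡ 𝟙 → x ≤ y
  ⇒≡𝟙⇒≤ {x} {y} x⇒y≡𝟙 ∼y⇒∼x≡𝟙 =
    ≤-by-∨-cases (⇒≡𝟙⇒≤∼∨ x⇒y≡𝟙) (x∧∼y≤y⇒x∧∼x≤y x∧∼y≤y) (x∧y≤y x y)
    where
    ∼y≤y∨∼x : ∼ y ≤ y ∨ ∼ x
    ∼y≤y∨∼x = subst (λ t → ∼ y ≤ t ∨ ∼ x) (∼-invol y) (⇒≡𝟙⇒≤∼∨ ∼y⇒∼x≡𝟙)
    x∧∼y≤y : x ∧ ∼ y ≤ y
    x∧∼y≤y = subst (x ∧ ∼ y ≤_) (∼-invol y) (x≤y∨∼z⇒z∧∼y≤∼x ∼y≤y∨∼x)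

  ρ-inK : ∀ x → InK (ρ x)
  ρ-inK x = swap (subst (_θ x ∧ ∼ x) ∼[x⇒x]≡𝟘 (∼⇒θ∧∼ x x))
    where
    ∼[x⇒x]≡𝟘 : ∼ (x ⇒ x) ≡ 𝟘
    ∼[x⇒x]≡𝟘 = trans (cong ∼_ (hN1 x)) ∼𝟙≡𝟘

  ρ-∧ : ∀ x y → ρ (x ∧ y) ≈K ρ x ∧K ρ y
  ρ-∧ x y = θ-refl (x ∧ y) , θ-reflexive (∼-deMorgan x y)

  ρ-∨ : ∀ x y → ρ (x ∨ y) ≈K ρ x ∨K ρ y
  ρ-∨ x y = θ-refl (x ∨ y) , θ-reflexive (∼-deMorgan-∨ x y)

  ρ-⇒ : ∀ x y → ρ (x ⇒ y) ≈K ρ x ⇒K ρ y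
  ρ-⇒ x y = θ-refl (x ⇒ y) , ∼⇒θ∧∼ x y

  ρ-∼ : ∀ x → ρ (∼ x) ≈K ∼K ρ x
  ρ-∼ x = θ-refl (∼ x) , θ-reflexive (∼-invol x)

  ρ-𝟘 : ρ 𝟘 ≈K 𝟘K
  ρ-𝟘 = θ-refl 𝟘 , θ-reflexive ∼𝟘≡𝟙

  ρ-𝟙 : ρ 𝟙 ≈K 𝟙K
  ρ-𝟙 = θ-refl 𝟙 , θ-reflexive ∼𝟙≡𝟘

  ρ-injective : ∀ x y → ρ x ≈K ρ y → x ≡ y
  ρ-injective x y ((x⇒y≡𝟙 , y⇒x≡𝟙) , (∼x⇒∼y≡𝟙 , ∼y⇒∼x≡𝟙)) =
    antisym (⇒≡𝟙⇒≤ x⇒y≡𝟙 ∼y⇒∼x≡𝟙) (⇒≡𝟙⇒≤ y⇒x≡𝟙 ∼x⇒∼y≡𝟙)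

theorem11 : {T : Set} (H : HemiNelson T) → let open HemiNelson H in
    -- well defined: ρ x lies in K(T/θ)
    (∀ x → InK (ρ x))
    -- homomorphism for ∧, ∨, →, ∼, 0, 1
    × (∀ x y → ρ (x ∧ y) ≈K (ρ x ∧K ρ y))
    × (∀ x y → ρ (x ∨ y) ≈K (ρ x ∨K ρ y))
    × (∀ x y → ρ (x ⇒ y) ≈K (ρ x ⇒K ρ y))
    × (∀ x → ρ (∼ x) ≈K (∼K (ρ x)))
    × (ρ 𝟘 ≈K 𝟘K)
    × (ρ 𝟙 ≈K 𝟙K)
    -- injective
    × (∀ x y → ρ x ≈K ρ y → x ≡ y)
theorem11 H = ρ-inK , ρ-∧ , ρ-∨ , ρ-⇒ , ρ-∼ , ρ-𝟘 , ρ-𝟙 , ρ-injective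
  where open HemiNelsonProperties H
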